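{- Let $(X,Y)$ be a $G$-duet. If $d(X,Y)$ and $d(Y,X)$ are finite and relatively prime, then $G$ acts transitively on the set $\{(x,y)\in X\times Y: x\sim y\}$.
   Context: A $G$-duet $(X,Y)$ consists of two disjoint sets $X,Y$, a symmetric incidence relation $\sim$ between points of $X$ and points of $Y$ (no two points of the same set are incident), and an action of the group $G$ on $X\cup Y$ that maps $X$ to $X$, $Y$ to $Y$, acts transitively on $X$ and on $Y$, and preserves incidence; moreover the point stabilizers $G_x$ ($x\in X$) and $G_y$ ($y\in Y$) are finite, and writing $N(x)=\{y\in Y:y\sim x\}$, at least one of $|G_y|\cdot|N(x)|$ or $|G_y|\cdot|Y\setminus N(x)|$ is finite. $d(X,Y)=|N(x)\cap Y|$ for $x\in X$ (independent of $x$), and $d(Y,X)=|\{x\in X: x\sim y\}|$ for $y\in Y$. -}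

module Defs where

open import Level using (Level; _⊔_)
open import Data.Nat using (ℕ)
open import Data.Fin using (Fin)
open import Data.Product using (Σ; ∃; _×_; _,_)
open import Data.Sum using (_⊎_)
open import Relation.Nullary using (¬_)
open import Relation.Binary.PropositionalEquality using (_≡_)
open import Algebra.Bundles using (Group)

HasSize : ∀ {a ℓ p} {A : Set a} (_≈_ : A → A → Set ℓ) (P : A → Set p) → ℕ
        → Set (a ⊔ ℓ ⊔ p)
HasSize {A = A} _≈_ P n =
  Σ (Fin n → A) λ f →
    (∀ i → P (f i)) ×
    (∀ i j → f i ≈ f j → i ≡ j) ×
    (∀ z → P z → ∃ λ i → z ≈ f i)

Finite : ∀ {a ℓ p} {A : Set a} (_≈_ : A → A → Set ℓ) (P : A → Set p)
       → Set (a ⊔ ℓ ⊔ p)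
Finite _≈_ P = ∃ λ n → HasSize _≈_ P n

IsTransitive : ∀ {c a} {G : Set c} {X : Set a} (act : G → X → X) → Set (c ⊔ a)
IsTransitive {X = X} act = X × (∀ (x x′ : X) → ∃ λ g → act g x ≡ x′)

record IsAction {c ℓ a} (G : Group c ℓ) {X : Set a}
                (act : Group.Carrier G → X → X) : Set (c ⊔ ℓ ⊔ a) where
  open Group G
  field
    act-id   : ∀ x → act ε x ≡ x
    act-comp : ∀ g h x → act (g ∙ h) x ≡ act g (act h x)
    act-resp : ∀ {g h} → g ≈ h → ∀ x → act g x ≡ act h x

-- A G-duet (X,Y): X and Y are disjoint (given as separate types), _∼_ is the
-- incidence relation between X and Y, actX / actY the actions of G.
record IsGDuet {c ℓ a r} (G : Group c ℓ) (X Y : Set a) (_∼_ : X → Y → Set r)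
               (actX : Group.Carrier G → X → X)
               (actY : Group.Carrier G → Y → Y) : Set (c ⊔ ℓ ⊔ a ⊔ r) where
  open Group G
  field
    isActionX : IsAction G actX
    isActionY : IsAction G actY
    transX    : IsTransitive actX
    transY    : IsTransitive actY
    preserves : ∀ g x y → x ∼ y → actX g x ∼ actY g y
    stabX-fin : ∀ x → Finite _≈_ (λ g → actX g x ≡ x)
    stabY-fin : ∀ y → Finite _≈_ (λ g → actY g y ≡ y)
    -- |G_y|·|N(x)| or |G_y|·|Y∖N(x)| finite; since G_y is finite and nonempty
    -- this says N(x) or Y∖N(x) is finite.
    nbhd-fin  : ∀ x → Finite _≡_ (λ y → x ∼ y) ⊎ Finite _≡_ (λ y → ¬ (x ∼ y))

module Submission where

-- Fix a flag x₀ ∼ y₀ and write S = |G_{x₀}|, T = |G_{y₀}|.  For a transitive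
-- action with stabilizer G_{z₀} and a finite set R of points, the elements g
-- with g·z₀ ∈ R number |R|·|G_{z₀}| (orbit-stabilizer counting).  Inversion
-- g ↦ g⁻¹ matches {g | x₀ ∼ g·y₀} with {g | g·x₀ ∼ y₀}, hence
--     d(X,Y)·T = d(Y,X)·S.
-- It also matches {g | g·y₀ ∈ G_{x₀}·y₀} = G_{x₀}G_{y₀} with G_{y₀}G_{x₀},
-- so with α = |G_{x₀}·y₀| and β = |G_{y₀}·x₀| we get α·T = β·S.  Hence
-- α·d(Y,X) = β·d(X,Y); coprimality gives d(X,Y) ∣ α, and as 0 < α ≤ d(X,Y)
-- the orbit G_{x₀}·y₀ is all of N(x₀).

open import Defs
open import Data.Nat using (ℕ)
open import Data.Nat.Coprimality using (Coprime)
open import Data.Product using (∃; _×_)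
open import Relation.Binary.PropositionalEquality using (_≡_)
open import Algebra.Bundles using (Group)

open import Data.Nat using (zero; suc; _*_; _≤_; NonZero)
import Data.Nat.Properties as ℕP
open import Data.Nat.Divisibility using (_∣_; divides; ∣⇒≤)
open import Data.Nat.Coprimality using (coprime-divisor)
open import Data.Fin using (Fin; combine; remQuot)
import Data.Fin as F
import Data.Fin.Properties as FP
open import Data.Product using (_,_; proj₁; proj₂; uncurry)
open import Data.Empty using (⊥-elim)
open import Relation.Nullary using (Dec; yes; no)
open import Relation.Binary using (IsEquivalence)
import Relation.Binary.PropositionalEquality as P
open import Function using (_∘_)
open import Level using (_⊔_)

module Enumeration {a ℓ p} {A : Set a} {_≈_ : A → A → Set ℓ} {Q : A → Set p}
                   {n : ℕ} (h : HasSize _≈_ Q n) where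
  element : Fin n → A
  element = proj₁ h

  element-∈ : ∀ i → Q (element i)
  element-∈ = proj₁ (proj₂ h)

  element-injective : ∀ i j → element i ≈ element j → i ≡ j
  element-injective = proj₁ (proj₂ (proj₂ h))

  index : ∀ z → Q z → Fin n
  index z q = proj₁ (proj₂ (proj₂ (proj₂ h)) z q)

  index-correct : ∀ z (q : Q z) → z ≈ element (index z q)
  index-correct z q = proj₂ (proj₂ (proj₂ (proj₂ h)) z q)

HasSize-≤ : ∀ {a ℓ p} {A : Set a} {_≈_ : A → A → Set ℓ} {Q : A → Set p} {m n}
  → IsEquivalence _≈_ → HasSize _≈_ Q m → HasSize _≈_ Q n → m ≤ n
HasSize-≤ {_≈_ = _≈_} {m = m} {n = n} isEq hm hn = FP.injective⇒≤ {f = toN} toN-injective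
  where
  open IsEquivalence isEq
  module M = Enumeration {_≈_ = _≈_} hm
  module N = Enumeration {_≈_ = _≈_} hn
  toN : Fin m → Fin n
  toN i = N.index (M.element i) (M.element-∈ i)
  toN-injective : ∀ {i j} → toN i ≡ toN j → i ≡ j
  toN-injective {i} {j} eq = M.element-injective i j
    (trans (N.index-correct _ _)
      (P.subst (λ k → N.element k ≈ M.element j) (P.sym eq)
        (sym (N.index-correct _ _))))

HasSize-unique : ∀ {a ℓ p} {A : Set a} {_≈_ : A → A → Set ℓ} {Q : A → Set p} {m n}
  → IsEquivalence _≈_ → HasSize _≈_ Q m → HasSize _≈_ Q n → m ≡ n
HasSize-unique isEq hm hn = ℕP.≤-antisym (HasSize-≤ isEq hm hn) (HasSize-≤ isEq hn hm)

subsetSize : ∀ {p} n (D : Fin n → Set p) → (∀ i → Dec (D i))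
  → ∃ λ m → HasSize _≡_ D m × (m ≡ n → ∀ j → D j)
subsetSize zero D D? = 0 , ((λ ()) , (λ ()) , (λ ()) , (λ ())) , λ _ ()
subsetSize (suc n) D D? with subsetSize n (D ∘ F.suc) (D? ∘ F.suc) | D? F.zero
... | m , (g , Dg , g-inj , g-cov) , full | yes D0 =
  suc m , (g′ , Dg′ , g′-inj , g′-cov) , full′
  where
  g′ : Fin (suc m) → Fin (suc n)
  g′ F.zero    = F.zero
  g′ (F.suc i) = F.suc (g i)
  Dg′ : ∀ i → D (g′ i)
  Dg′ F.zero    = D0
  Dg′ (F.suc i) = Dg i
  g′-inj : ∀ i j → g′ i ≡ g′ j → i ≡ j
  g′-inj F.zero    F.zero    _  = P.refl
  g′-inj (F.suc i) (F.suc j) eq = P.cong F.suc (g-inj i j (FP.suc-injective eq))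
  g′-cov : ∀ j → D j → ∃ λ i → j ≡ g′ i
  g′-cov F.zero    _  = F.zero , P.refl
  g′-cov (F.suc j) Dj = F.suc (proj₁ (g-cov j Dj)) , P.cong F.suc (proj₂ (g-cov j Dj))
  full′ : suc m ≡ suc n → ∀ j → D j
  full′ _  F.zero    = D0
  full′ eq (F.suc j) = full (ℕP.suc-injective eq) j
... | m , (g , Dg , g-inj , g-cov) , _ | no ¬D0 =
  m , (F.suc ∘ g , Dg , (λ i j eq → g-inj i j (FP.suc-injective eq)) , g′-cov) , full′
  where
  g′-cov : ∀ j → D j → ∃ λ i → j ≡ F.suc (g i)
  g′-cov F.zero    D0 = ⊥-elim (¬D0 D0)
  g′-cov (F.suc j) Dj = proj₁ (g-cov j Dj) , P.cong F.suc (proj₂ (g-cov j Dj))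
  -- m ≤ n because g injects Fin m into Fin n, so m ≢ suc n.
  full′ : m ≡ suc n → ∀ j → D j
  full′ eq = ⊥-elim (ℕP.1+n≰n (P.subst (_≤ n) eq (FP.injective⇒≤ (g-inj _ _))))

Image : ∀ {a} {Z : Set a} {S : ℕ} → (Fin S → Z) → Z → Set a
Image f z = ∃ λ k → f k ≡ z

record ImageIn {a p} {Z : Set a} {S : ℕ} (f : Fin S → Z)
               (N : Z → Set p) (d : ℕ) : Set (a ⊔ p) where
  field
    size  : ℕ
    sized : HasSize _≡_ (Image f) size
    size≤ : size ≤ d
    full  : size ≡ d → ∀ z → N z → Image f z

-- Computed by locating each f k in the enumeration of N and counting the
-- decidable set of positions that are hit.
imageIn : ∀ {a p} {Z : Set a} {N : Z → Set p} {d S}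
  → HasSize _≡_ N d → (f : Fin S → Z) → (∀ k → N (f k)) → ImageIn f N d
imageIn {Z = Z} {N} {d} {S} hN f f∈N = record
  { size  = m
  ; sized = e ∘ g , g∈Image , (λ i j eq → g-inj i j (e-inj _ _ eq)) , covers
  ; size≤ = FP.injective⇒≤ (g-inj _ _)
  ; full  = full
  }
  where
  open Enumeration {_≈_ = _≡_} hN renaming (element to e; element-injective to e-inj)
  pos : Fin S → Fin d
  pos k = index (f k) (f∈N k)
  Hit : Fin d → Set
  Hit i = ∃ λ k → pos k ≡ i
  hits : ∃ λ m → HasSize _≡_ Hit m × (m ≡ d → ∀ i → Hit i)
  hits = subsetSize d Hit (λ i → FP.any? (λ k → pos k FP.≟ i))
  m : ℕ
  m = proj₁ hits
  open Enumeration {_≈_ = _≡_} (proj₁ (proj₂ hits))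
    renaming (element to g; element-∈ to g-hit; element-injective to g-inj;
              index to g-index; index-correct to g-index-correct)
  pos-correct : ∀ k {i} → pos k ≡ i → f k ≡ e i
  pos-correct k eq = P.trans (index-correct (f k) (f∈N k)) (P.cong e eq)
  g∈Image : ∀ i → Image f (e (g i))
  g∈Image i = proj₁ (g-hit i) , pos-correct _ (proj₂ (g-hit i))
  covers : ∀ z → Image f z → ∃ λ i → z ≡ e (g i)
  covers z (k , fk≡z) = g-index (pos k) (k , P.refl) ,
    P.trans (P.sym fk≡z) (pos-correct k (g-index-correct (pos k) (k , P.refl)))
  full : m ≡ d → ∀ z → N z → Image f z
  full m≡d z Nz with proj₂ (proj₂ hits) m≡d (index z Nz)
  ... | k , eq = k , P.trans (pos-correct k eq) (P.sym (index-correct z Nz))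

module GroupCounting {c ℓ} (G : Group c ℓ) where
  open Group G using (Carrier; _≈_; _∙_; _⁻¹; inverseˡ; isEquivalence; ∙-cong; ⁻¹-cong)
    renaming (refl to ≈-refl; sym to ≈-sym; trans to ≈-trans)
  open import Algebra.Properties.Group G
    using (⁻¹-involutive; ⁻¹-injective; ∙-cancelˡ; \\-leftDividesˡ)

  HasSize-⁻¹ : ∀ {p q} {Q₁ : Carrier → Set p} {Q₂ : Carrier → Set q} {n}
    → HasSize _≈_ Q₁ n → (∀ g → Q₁ g → Q₂ (g ⁻¹)) → (∀ g → Q₂ g → Q₁ (g ⁻¹))
    → HasSize _≈_ Q₂ n
  HasSize-⁻¹ (f , f∈ , f-inj , f-cov) to from =
    (λ i → f i ⁻¹) , (λ i → to _ (f∈ i)) , (λ i j eq → f-inj i j (⁻¹-injective eq)) ,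
    λ g q → proj₁ (f-cov _ (from g q)) ,
      ≈-trans (≈-sym (⁻¹-involutive g)) (⁻¹-cong (proj₂ (f-cov _ (from g q))))

  module Action {a} {Z : Set a} (act : Carrier → Z → Z) (isAction : IsAction G act) where
    open IsAction isAction

    act-⁻¹ : ∀ g z → act (g ⁻¹) (act g z) ≡ z
    act-⁻¹ g z = P.trans (P.sym (act-comp _ _ z)) (P.trans (act-resp (inverseˡ g) z) (act-id z))

    divide : ∀ g h z z′ → act g z ≡ act h z′ → act (h ⁻¹ ∙ g) z ≡ z′
    divide g h z z′ eq =
      P.trans (act-comp _ _ z) (P.trans (P.cong (act (h ⁻¹)) eq) (act-⁻¹ h z′))

    -- They are exactly the
    -- products rep(i) ∙ s(k), where rep(i) sends z₀ to the i-th point of R and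
    -- s enumerates G_{z₀}.
    preimageSize : (z₀ : Z) → (∀ z → ∃ λ g → act g z₀ ≡ z)
      → ∀ {t} → HasSize _≈_ (λ g → act g z₀ ≡ z₀) t
      → ∀ {p} {R : Z → Set p} {α} → HasSize _≡_ R α
      → HasSize _≈_ (λ g → R (act g z₀)) (α * t)
    preimageSize z₀ transitive {t} stab {R = R} {α} hR =
      product ∘ remQuot t , product∈ , product-injective , product-covers
      where
      open Enumeration {_≈_ = _≈_} stab
        renaming (element to s; element-∈ to s-stab; element-injective to s-inj;
                  index to s-index; index-correct to s-index-correct)
      open Enumeration {_≈_ = _≡_} hR
        renaming (element to e; element-∈ to e∈R; element-injective to e-inj;
                  index to e-index; index-correct to e-index-correct)
      rep : Fin α → Carrier
      rep i = proj₁ (transitive (e i))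
      product : Fin α × Fin t → Carrier
      product (i , k) = rep i ∙ s k
      product-sends : ∀ ik → act (product ik) z₀ ≡ e (proj₁ ik)
      product-sends (i , k) = P.trans (act-comp _ _ z₀)
        (P.trans (P.cong (act (rep i)) (s-stab k)) (proj₂ (transitive (e i))))
      product∈ : ∀ p → R (act (product (remQuot t p)) z₀)
      product∈ p = P.subst R (P.sym (product-sends _)) (e∈R _)
      pair-injective : ∀ ik jl → product ik ≈ product jl → ik ≡ jl
      pair-injective (i , k) (j , l) eq
        with e-inj i j (P.trans (P.sym (product-sends (i , k)))
                         (P.trans (act-resp eq z₀) (product-sends (j , l))))
      ... | P.refl = P.cong (i ,_) (s-inj k l (∙-cancelˡ (rep i) (s k) (s l) eq))
      product-injective : ∀ p q → product (remQuot t p) ≈ product (remQuot t q) → p ≡ q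
      product-injective p q eq = P.trans (P.sym (FP.combine-remQuot {α} t p))
        (P.trans (P.cong (uncurry combine) (pair-injective _ _ eq)) (FP.combine-remQuot {α} t q))
      product-covers : ∀ g → R (act g z₀) → ∃ λ p → g ≈ product (remQuot t p)
      product-covers g Rg = combine i k ,
          P.subst (λ ik → g ≈ product ik) (P.sym (FP.remQuot-combine i k))
            (≈-trans (≈-sym (\\-leftDividesˡ (rep i) g)) (∙-cong ≈-refl (s-index-correct _ w-stab)))
        where
        i : Fin α
        i = e-index _ Rg
        w-stab : act (rep i ⁻¹ ∙ g) z₀ ≡ z₀
        w-stab = divide g (rep i) z₀ z₀
          (P.trans (e-index-correct _ Rg) (P.sym (proj₂ (transitive (e i)))))
        k : Fin t
        k = s-index _ w-stab

  module TwoActions {a b} {A : Set a} {B : Set b}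
    (actA : Carrier → A → A) (isA : IsAction G actA)
    (actB : Carrier → B → B) (isB : IsAction G actB) where
    module ActA = Action actA isA
    module ActB = Action actB isB
    open IsAction

    -- If g·b₀ ∈ G_{a₀}·b₀ then g⁻¹·a₀ ∈ G_{b₀}·a₀: the sets G_{a₀}G_{b₀} and
    -- G_{b₀}G_{a₀} are inverse to each other.
    cosetSwap : (a₀ : A) (b₀ : B) {S T : ℕ}
      (stabA : HasSize _≈_ (λ g → actA g a₀ ≡ a₀) S)
      (stabB : HasSize _≈_ (λ g → actB g b₀ ≡ b₀) T)
      → ∀ g → Image (λ k → actB (proj₁ stabA k) b₀) (actB g b₀)
      → Image (λ l → actA (proj₁ stabB l) a₀) (actA (g ⁻¹) a₀)
    cosetSwap a₀ b₀ {T = T} stabA stabB g (k , eq) = l ,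
        P.trans (act-resp isA (≈-sym w≈ul) a₀)
          (P.trans (act-comp isA _ _ a₀) (P.cong (actA (g ⁻¹)) (s-stab k)))
      where
      open Enumeration {_≈_ = _≈_} stabA renaming (element to s; element-∈ to s-stab)
      open Enumeration {_≈_ = _≈_} stabB renaming (index to u-index; index-correct to u-index-correct)
      w-stab : actB (g ⁻¹ ∙ s k) b₀ ≡ b₀
      w-stab = ActB.divide (s k) g b₀ b₀ eq
      l : Fin T
      l = u-index _ w-stab
      w≈ul : g ⁻¹ ∙ s k ≈ proj₁ stabB l
      w≈ul = u-index-correct _ w-stab

    -- Double counting: when g·b₀ ∈ R_B ⇔ g⁻¹·a₀ ∈ R_A, the inversion bijects
    -- {g | g·b₀ ∈ R_B} with {g | g·a₀ ∈ R_A}, so |R_B|·|G_{b₀}| = |R_A|·|G_{a₀}|.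
    doubleCount : (a₀ : A) (b₀ : B)
      → (∀ a → ∃ λ g → actA g a₀ ≡ a) → (∀ b → ∃ λ g → actB g b₀ ≡ b)
      → ∀ {S T} → HasSize _≈_ (λ g → actA g a₀ ≡ a₀) S
      → HasSize _≈_ (λ g → actB g b₀ ≡ b₀) T
      → ∀ {p q} {RA : A → Set p} {RB : B → Set q} {α β}
      → HasSize _≡_ RB α → HasSize _≡_ RA β
      → (∀ g → RB (actB g b₀) → RA (actA (g ⁻¹) a₀))
      → (∀ g → RA (actA g a₀) → RB (actB (g ⁻¹) b₀))
      → α * T ≡ β * S
    doubleCount a₀ b₀ transA transB stabA stabB hB hA to from =
      HasSize-unique isEquivalence
        (ActB.preimageSize b₀ transB stabB hB)
        (HasSize-⁻¹ (ActA.preimageSize a₀ transA stabA hA) from to)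

-- Cross-multiplying a·T = b·S and α·T = β·S (S ≠ 0) gives b·α = β·a, so a
-- coprime to b divides α.
coprime-ratio-divides : ∀ {a b α β S T} .{{_ : NonZero S}} → Coprime a b
  → a * T ≡ b * S → α * T ≡ β * S → a ∣ α
coprime-ratio-divides {a} {b} {α} {β} {S} {T} coprime aT≡bS αT≡βS =
  coprime-divisor coprime (divides β (ℕP.*-cancelʳ-≡ (b * α) (β * a) S (begin
    b * α * S     ≡⟨ xy∙z≈y∙xz b α S ⟩
    α * (b * S)   ≡⟨ P.cong (α *_) (P.sym aT≡bS) ⟩
    α * (a * T)   ≡⟨ x∙yz≈y∙xz α a T ⟩
    a * (α * T)   ≡⟨ P.cong (a *_) αT≡βS ⟩
    a * (β * S)   ≡⟨ P.sym (xy∙z≈y∙xz β a S) ⟩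
    β * a * S     ∎)))
  where
  open P.≡-Reasoning
  open import Algebra.Properties.CommutativeSemigroup ℕP.*-commutativeSemigroup
    using (xy∙z≈y∙xz; x∙yz≈y∙xz)

-- In a bipartite incidence structure with constant valencies m, n on
-- nonempty sides, coprimality excludes m = n = 0, so some incidence exists.
incidence-exists : ∀ {a r} {X Y : Set a} {_∼_ : X → Y → Set r} → X → Y → ∀ {m n}
  → (∀ x → HasSize _≡_ (λ y → x ∼ y) m) → (∀ y → HasSize _≡_ (λ x → x ∼ y) n)
  → Coprime m n → ∃ λ x → ∃ λ y → x ∼ y
incidence-exists x y {suc m} hX hY _ = x , proj₁ (hX x) F.zero , proj₁ (proj₂ (hX x)) F.zero
incidence-exists x y {zero} {suc n} hX hY _ = proj₁ (hY y) F.zero , y , proj₁ (proj₂ (hY y)) F.zero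
incidence-exists x y {zero} {zero} hX hY coprime
  with () ← coprime {2} (divides 0 P.refl , divides 0 P.refl)

module Duet {c ℓ a r} (G : Group c ℓ) (X Y : Set a) (_∼_ : X → Y → Set r)
  (actX : Group.Carrier G → X → X) (actY : Group.Carrier G → Y → Y)
  (duet : IsGDuet G X Y _∼_ actX actY) (dXY dYX : ℕ)
  (hX : ∀ x → HasSize _≡_ (λ y → x ∼ y) dXY)
  (hY : ∀ y → HasSize _≡_ (λ x → x ∼ y) dYX)
  (coprime : Coprime dXY dYX) where
  open Group G using (Carrier; _≈_; _∙_; ε; _⁻¹) renaming (sym to ≈-sym)
  open IsGDuet duet
  open IsAction
  open GroupCounting G
  open TwoActions actX isActionX actY isActionY
  module YX = TwoActions actY isActionY actX isActionX
  open ImageIn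

  moveX : ∀ x₀ x → ∃ λ g → actX g x₀ ≡ x
  moveX = proj₂ transX

  moveY : ∀ y₀ y → ∃ λ g → actY g y₀ ≡ y
  moveY = proj₂ transY

  flag-⁻¹ʳ : ∀ g x₀ y₀ → x₀ ∼ actY g y₀ → actX (g ⁻¹) x₀ ∼ y₀
  flag-⁻¹ʳ g x₀ y₀ f = P.subst (actX (g ⁻¹) x₀ ∼_) (ActB.act-⁻¹ g y₀) (preserves (g ⁻¹) _ _ f)

  flag-⁻¹ˡ : ∀ g x₀ y₀ → actX g x₀ ∼ y₀ → x₀ ∼ actY (g ⁻¹) y₀
  flag-⁻¹ˡ g x₀ y₀ f = P.subst (_∼ actY (g ⁻¹) y₀) (ActA.act-⁻¹ g x₀) (preserves (g ⁻¹) _ _ f)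

  module AtFlag (x₀ : X) (y₀ : Y) (flag : x₀ ∼ y₀) where
    S T : ℕ
    S = proj₁ (stabX-fin x₀)
    T = proj₁ (stabY-fin y₀)
    stabX : HasSize _≈_ (λ g → actX g x₀ ≡ x₀) S
    stabX = proj₂ (stabX-fin x₀)
    stabY : HasSize _≈_ (λ g → actY g y₀ ≡ y₀) T
    stabY = proj₂ (stabY-fin y₀)
    open Enumeration {_≈_ = _≈_} stabX
      renaming (element to s; element-∈ to s-stab; index to s-index; index-correct to s-index-correct)
    open Enumeration {_≈_ = _≈_} stabY
      renaming (element to u; element-∈ to u-stab)

    -- Double counting the elements g with x₀ ∼ g·y₀.
    valency-count : dXY * T ≡ dYX * S
    valency-count = doubleCount x₀ y₀ (moveX x₀) (moveY y₀) stabX stabY (hX x₀) (hY y₀)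
      (λ g → flag-⁻¹ʳ g x₀ y₀) (λ g → flag-⁻¹ˡ g x₀ y₀)

    orbitY : ImageIn (λ k → actY (s k) y₀) (λ y → x₀ ∼ y) dXY
    orbitY = imageIn (hX x₀) _ λ k →
      P.subst (_∼ actY (s k) y₀) (s-stab k) (preserves (s k) _ _ flag)

    orbitX : ImageIn (λ l → actX (u l) x₀) (λ x → x ∼ y₀) dYX
    orbitX = imageIn (hY y₀) _ λ l →
      P.subst (actX (u l) x₀ ∼_) (u-stab l) (preserves (u l) _ _ flag)

    -- Double counting the elements of G_{x₀}G_{y₀}.
    orbit-count : size orbitY * T ≡ size orbitX * S
    orbit-count = doubleCount x₀ y₀ (moveX x₀) (moveY y₀) stabX stabY
      {RA = Image (λ l → actX (u l) x₀)} {RB = Image (λ k → actY (s k) y₀)}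
      (sized orbitY) (sized orbitX) (cosetSwap x₀ y₀ stabX stabY) (YX.cosetSwap y₀ x₀ stabY stabX)

    -- ε ∈ G_{x₀}, so G_{x₀} and the orbit G_{x₀}·y₀ ∋ y₀ are nonempty.
    ε-index : Fin S
    ε-index = s-index ε (act-id isActionX x₀)

    y₀∈orbitY : Image (λ k → actY (s k) y₀) y₀
    y₀∈orbitY = ε-index ,
      P.trans (act-resp isActionY (≈-sym (s-index-correct ε (act-id isActionX x₀))) y₀)
              (act-id isActionY y₀)

    orbitY-full : size orbitY ≡ dXY
    orbitY-full = ℕP.≤-antisym (size≤ orbitY) (∣⇒≤ {{nonZero-α}} dXY∣α)
      where
      nonZero-S : NonZero S
      nonZero-S = FP.nonZeroIndex ε-index
      nonZero-α : NonZero (size orbitY)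
      nonZero-α = FP.nonZeroIndex (Enumeration.index {_≈_ = _≡_} (sized orbitY) y₀ y₀∈orbitY)
      dXY∣α : dXY ∣ size orbitY
      dXY∣α = coprime-ratio-divides {dXY} {dYX} {size orbitY} {size orbitX} {S} {T} {{nonZero-S}}
        coprime valency-count orbit-count

    stabilizer-transitive : ∀ y → x₀ ∼ y → ∃ λ g → actX g x₀ ≡ x₀ × actY g y₀ ≡ y
    stabilizer-transitive y x₀∼y = s k , s-stab k , sk·y₀≡y
      where
      k : Fin S
      k = proj₁ (full orbitY orbitY-full y x₀∼y)
      sk·y₀≡y : actY (s k) y₀ ≡ y
      sk·y₀≡y = proj₂ (full orbitY orbitY-full y x₀∼y)

  flag-exists : ∃ λ x → ∃ λ y → x ∼ y
  flag-exists = incidence-exists (proj₁ transX) (proj₁ transY) hX hY coprime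

  -- Any flag (x,y) is moved to any other (x′,y′): first h moves x′ to x, then
  -- an element k of G_x moves y to h·y′; the element h⁻¹ ∙ k does the job.
  flag-transitive : ∀ x y x′ y′ → x ∼ y → x′ ∼ y′
    → ∃ λ g → actX g x ≡ x′ × actY g y ≡ y′
  flag-transitive x y x′ y′ f f′ =
    h ⁻¹ ∙ k ,
    ActA.divide k h x x′ (P.trans k·x≡x (P.sym h·x′≡x)) ,
    ActB.divide k h y y′ k·y≡h·y′
    where
    h : Carrier
    h = proj₁ (moveX x′ x)
    h·x′≡x : actX h x′ ≡ x
    h·x′≡x = proj₂ (moveX x′ x)
    -- (x, h·y′) is a flag, the image of (x′,y′) under h
    moved : ∃ λ k → actX k x ≡ x × actY k y ≡ actY h y′
    moved = AtFlag.stabilizer-transitive x y f (actY h y′)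
              (P.subst (_∼ actY h y′) h·x′≡x (preserves h _ _ f′))
    k : Carrier
    k = proj₁ moved
    k·x≡x : actX k x ≡ x
    k·x≡x = proj₁ (proj₂ moved)
    k·y≡h·y′ : actY k y ≡ actY h y′
    k·y≡h·y′ = proj₂ (proj₂ moved)

lemma7p5 : ∀ {c ℓ a r} (G : Group c ℓ) (X Y : Set a) (_∼_ : X → Y → Set r)
    (actX : Group.Carrier G → X → X) (actY : Group.Carrier G → Y → Y)
    → IsGDuet G X Y _∼_ actX actY
    → (dXY dYX : ℕ)
    → (∀ x → HasSize _≡_ (λ y → x ∼ y) dXY)
    → (∀ y → HasSize _≡_ (λ x → x ∼ y) dYX)
    → Coprime dXY dYX
    → (∃ λ x → ∃ λ y → x ∼ y)
    × (∀ x y x′ y′ → x ∼ y → x′ ∼ y′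
    → ∃ λ g → actX g x ≡ x′ × actY g y ≡ y′)
lemma7p5 G X Y _∼_ actX actY duet dXY dYX hX hY coprime =
  flag-exists , flag-transitive
  where open Duet G X Y _∼_ actX actY duet dXY dYX hX hY coprime
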